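{- Let $G$ be a finite multigraph and let $\overrightarrow{G^{1}}$ and $\overrightarrow{G^{2}}$ be two equivalent orientations of $G$. Then $\overrightarrow{G^{1}}$ and $\overrightarrow{G^{2}}$ have the same strongly connected components (i.e. the partitions of the vertex set into strongly connected components coincide).
   Context: A direction assignment (orientation) of a multigraph $G=(V,E)$ assigns to each edge an initial and a terminal vertex among its endpoints; the out-degree of a vertex is the number of edges directed out of it. Two orientations of $G$ are equivalent orientations if every vertex has the same out-degree in both. A directed graph is strongly connected if for any two vertices $i,j$ there are directed paths from $i$ to $j$ and from $j$ to $i$; the strongly connected components are the maximal strongly connected subgraphs. -}

module Defs where

open import Data.Nat using (ℕ)
open import Data.Fin using (Fin)
open import Data.Fin.Properties using (_≟_)
open import Data.Bool using (Bool; true; false)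
open import Data.Product using (_×_; _,_; proj₁; proj₂; ∃-syntax)
open import Data.List using (List; length; filter)
open import Data.List.Base using (allFin)
open import Relation.Binary.PropositionalEquality using (_≡_)
open import Relation.Binary.Construct.Closure.ReflexiveTransitive using (Star)
open import Relation.Unary using (Pred)
open import Relation.Nullary using (Dec)
open import Level using (0ℓ)

-- A finite multigraph with vertex set Fin n and edge set Fin m; edge e has
-- (unordered) endpoints ends e = (u , v). Loops (u = v) and parallel edges allowed.
record Multigraph : Set where
  field
    n    : ℕ
    m    : ℕ
    ends : Fin m → Fin n × Fin n
open Multigraph public

Orientation : Multigraph → Set
Orientation G = Fin (m G) → Bool

tail : (G : Multigraph) → Orientation G → Fin (m G) → Fin (n G)
tail G o e with o e
... | true  = proj₁ (ends G e)
... | false = proj₂ (ends G e)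

head : (G : Multigraph) → Orientation G → Fin (m G) → Fin (n G)
head G o e with o e
... | true  = proj₂ (ends G e)
... | false = proj₁ (ends G e)

outdeg : (G : Multigraph) → Orientation G → Fin (n G) → ℕ
outdeg G o v = length (filter (λ e → tail G o e ≟ v) (allFin (m G)))

Equivalent : (G : Multigraph) → Orientation G → Orientation G → Set
Equivalent G o₁ o₂ = ∀ v → outdeg G o₁ v ≡ outdeg G o₂ v

Arc : (G : Multigraph) → Orientation G → Fin (n G) → Fin (n G) → Set
Arc G o i j = ∃[ e ] (tail G o e ≡ i × head G o e ≡ j)

Reach : (G : Multigraph) → Orientation G → Fin (n G) → Fin (n G) → Set
Reach G o = Star (Arc G o)

SameSCC : (G : Multigraph) → Orientation G → Fin (n G) → Fin (n G) → Set
SameSCC G o i j = Reach G o i j × Reach G o j i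

Vertex : Multigraph → Set
Vertex G = Fin (n G)

-- The number of edges with tail in a vertex set S is the sum of the out-degrees over S, and it
-- splits into the edges with both ends in S, which do not depend on the orientation, and the arcs
-- leaving S. So equivalent orientations have the same number of arcs leaving every S, in
-- particular the same closed sets (those no arc leaves). The vertices reachable from i form a
-- closed set of the first orientation, hence of the second, so everything reachable from i in the
-- second orientation is reachable in the first: equivalent orientations have the same
-- reachability relation, hence the same strongly connected components.

module Submission where

open import Defs
open import Data.Bool.Base using (true; false; if_then_else_)
open import Data.Empty using (⊥-elim)
open import Data.Fin.Base using (Fin; zero; suc)
open import Data.Fin.Properties using (_≟_; any?)
open import Data.Fin.Subset using (Subset; _∈_; _∉_; _⊆_; _⊂_; _⊃_; _∪_; ⁅_⁆)
open import Data.Fin.Subset.Induction using (⊃-wellFounded)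
open import Data.Fin.Subset.Properties
  using (_∈?_; p⊆p∪q; x∈p∪q⁻; x∈p∪q⁺; x∈⁅x⁆; x∈⁅y⁆⇒x≡y)
open import Data.List.Base using (length; filter; tabulate)
open import Data.Nat.Base using (ℕ; zero; suc; _+_; _*_)
open import Data.Nat.Properties
  using (+-0-commutativeMonoid; +-*-semiring; *-identityʳ; *-zeroʳ; +-identityʳ;
         +-cancelˡ-≡; m+n≡0⇒m≡0; m+n≡0⇒n≡0)
import Data.Product.Base as Product
open import Data.Product.Base using (_×_; _,_; proj₁; proj₂; ∃-syntax)
open import Data.Sum.Base using (inj₁; inj₂)
open import Function.Base using (id; _∘_)
open import Function.Bundles using (_⇔_; mk⇔; Equivalence)
open import Induction.WellFounded using (Acc; acc)
open import Relation.Binary.Construct.Closure.ReflexiveTransitive using (ε; _◅_; _◅◅_)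
open import Relation.Binary.PropositionalEquality
  using (_≡_; refl; sym; trans; cong; cong₂; module ≡-Reasoning)
open import Relation.Nullary using (¬_; Dec; does; yes; no; ¬?; _×-dec_)
open import Relation.Nullary.Decidable using (decidable-stable)
open import Relation.Unary using (Pred; Decidable)

open import Algebra.Properties.CommutativeMonoid.Sum +-0-commutativeMonoid
  using (sum-syntax; ∑-comm; ∑-distrib-+; sum-cong-≗; sum-replicate-zero)
open import Algebra.Properties.Semiring.Sum +-*-semiring using (*-distribˡ-sum)

⟦_⟧ : ∀ {a} {A : Set a} → Dec A → ℕ
⟦ d ⟧ = if does d then 1 else 0

length-filter-tabulate : ∀ {a p k} {A : Set a} {P : Pred A p} (P? : Decidable P) (f : Fin k → A) →
  length (filter P? (tabulate f)) ≡ ∑[ i < k ] ⟦ P? (f i) ⟧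
length-filter-tabulate {k = zero}  P? f = refl
length-filter-tabulate {k = suc k} P? f with does (P? (f zero))
... | true  = cong suc (length-filter-tabulate P? (f ∘ suc))
... | false = length-filter-tabulate P? (f ∘ suc)

⟦⟧≡0⇒¬ : ∀ {a} {A : Set a} (d : Dec A) → ⟦ d ⟧ ≡ 0 → ¬ A
⟦⟧≡0⇒¬ (no ¬x) _ = ¬x

¬⇒⟦⟧≡0 : ∀ {a} {A : Set a} (d : Dec A) → ¬ A → ⟦ d ⟧ ≡ 0
¬⇒⟦⟧≡0 (yes x) ¬x = ⊥-elim (¬x x)
¬⇒⟦⟧≡0 (no _)  _  = refl

∑⟦⟧≡0⇔∀¬ : ∀ {k p} {P : Pred (Fin k) p} (P? : Decidable P) →
  ∑[ i < k ] ⟦ P? i ⟧ ≡ 0 ⇔ (∀ i → ¬ P i)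
∑⟦⟧≡0⇔∀¬ {k} {P = P} P? = mk⇔ (to P?) from
  where
  to : ∀ {k p} {P : Pred (Fin k) p} (P? : Decidable P) → ∑[ i < k ] ⟦ P? i ⟧ ≡ 0 → ∀ i → ¬ P i
  to P? sum≡0 zero    = ⟦⟧≡0⇒¬ (P? zero) (m+n≡0⇒m≡0 _ sum≡0)
  to P? sum≡0 (suc i) = to (P? ∘ suc) (m+n≡0⇒n≡0 ⟦ P? zero ⟧ sum≡0) i
  from : (∀ i → ¬ P i) → ∑[ i < k ] ⟦ P? i ⟧ ≡ 0
  from ∁P = trans (sum-cong-≗ (λ i → ¬⇒⟦⟧≡0 (P? i) (∁P i))) (sum-replicate-zero k)

∑-*-⟦≟⟧ : ∀ {k} (f : Fin k → ℕ) (t : Fin k) → ∑[ v < k ] (f v * ⟦ t ≟ v ⟧) ≡ f t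
∑-*-⟦≟⟧ {suc k} f zero = begin
  f zero * 1 + ∑[ v < k ] (f (suc v) * 0) ≡⟨ cong₂ _+_ (*-identityʳ (f zero)) rest≡0 ⟩
  f zero + 0                               ≡⟨ +-identityʳ (f zero) ⟩
  f zero                                   ∎
  where
  open ≡-Reasoning
  rest≡0 : ∑[ v < k ] (f (suc v) * 0) ≡ 0
  rest≡0 = trans (sum-cong-≗ (λ v → *-zeroʳ (f (suc v)))) (sum-replicate-zero k)
∑-*-⟦≟⟧ {suc k} f (suc t) =
  trans (cong (_+ ∑[ v < k ] (f (suc v) * ⟦ t ≟ v ⟧)) (*-zeroʳ (f zero))) (∑-*-⟦≟⟧ (f ∘ suc) t)

x∉p⇒p⊂p∪⁅x⁆ : ∀ {k} {p : Subset k} {x} → x ∉ p → p ⊂ p ∪ ⁅ x ⁆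
x∉p⇒p⊂p∪⁅x⁆ {x = x} x∉p = p⊆p∪q _ , x , x∈p∪q⁺ (inj₂ (x∈⁅x⁆ x)) , x∉p

module _ (G : Multigraph) where

  Leaves : Orientation G → Subset (n G) → Fin (m G) → Set
  Leaves o S e = tail G o e ∈ S × head G o e ∉ S

  leaves? : (o : Orientation G) (S : Subset (n G)) → Decidable (Leaves o S)
  leaves? o S e = tail G o e ∈? S ×-dec ¬? (head G o e ∈? S)

  Closed : Orientation G → Subset (n G) → Set
  Closed o S = ∀ e → ¬ Leaves o S e

  Inside : Subset (n G) → Fin (m G) → Set
  Inside S e = proj₁ (ends G e) ∈ S × proj₂ (ends G e) ∈ S

  inside? : (S : Subset (n G)) → Decidable (Inside S)
  inside? S e = proj₁ (ends G e) ∈? S ×-dec proj₂ (ends G e) ∈? S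

  edgesWithin : Subset (n G) → ℕ
  edgesWithin S = ∑[ e < m G ] ⟦ inside? S e ⟧

  arcsLeaving : Orientation G → Subset (n G) → ℕ
  arcsLeaving o S = ∑[ e < m G ] ⟦ leaves? o S e ⟧

  ⟦tail∈⟧≡⟦Inside⟧+⟦Leaves⟧ : ∀ o S e → ⟦ tail G o e ∈? S ⟧ ≡ ⟦ inside? S e ⟧ + ⟦ leaves? o S e ⟧
  ⟦tail∈⟧≡⟦Inside⟧+⟦Leaves⟧ o S e with o e
  ... | true  with does (proj₁ (ends G e) ∈? S) | does (proj₂ (ends G e) ∈? S)
  ...   | true  | true  = refl
  ...   | true  | false = refl
  ...   | false | _     = refl
  ⟦tail∈⟧≡⟦Inside⟧+⟦Leaves⟧ o S e | false with does (proj₁ (ends G e) ∈? S) | does (proj₂ (ends G e) ∈? S)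
  ...   | true  | true  = refl
  ...   | true  | false = refl
  ...   | false | true  = refl
  ...   | false | false = refl

  ∑⟦∈⟧*outdeg≡∑⟦tail∈⟧ : ∀ o S →
    ∑[ v < n G ] (⟦ v ∈? S ⟧ * outdeg G o v) ≡ ∑[ e < m G ] ⟦ tail G o e ∈? S ⟧
  ∑⟦∈⟧*outdeg≡∑⟦tail∈⟧ o S = begin
    ∑[ v < n G ] (⟦ v ∈? S ⟧ * outdeg G o v)
      ≡⟨ sum-cong-≗ (λ v → cong (⟦ v ∈? S ⟧ *_) (length-filter-tabulate (λ e → tail G o e ≟ v) id)) ⟩
    ∑[ v < n G ] (⟦ v ∈? S ⟧ * ∑[ e < m G ] ⟦ tail G o e ≟ v ⟧)
      ≡⟨ sum-cong-≗ (λ v → *-distribˡ-sum ⟦ v ∈? S ⟧ (λ e → ⟦ tail G o e ≟ v ⟧)) ⟩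
    ∑[ v < n G ] ∑[ e < m G ] (⟦ v ∈? S ⟧ * ⟦ tail G o e ≟ v ⟧)
      ≡⟨ ∑-comm (λ v e → ⟦ v ∈? S ⟧ * ⟦ tail G o e ≟ v ⟧) ⟩
    ∑[ e < m G ] ∑[ v < n G ] (⟦ v ∈? S ⟧ * ⟦ tail G o e ≟ v ⟧)
      ≡⟨ sum-cong-≗ (λ e → ∑-*-⟦≟⟧ (λ v → ⟦ v ∈? S ⟧) (tail G o e)) ⟩
    ∑[ e < m G ] ⟦ tail G o e ∈? S ⟧
      ∎
    where open ≡-Reasoning

  ∑⟦∈⟧*outdeg≡edgesWithin+arcsLeaving : ∀ o S →
    ∑[ v < n G ] (⟦ v ∈? S ⟧ * outdeg G o v) ≡ edgesWithin S + arcsLeaving o S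
  ∑⟦∈⟧*outdeg≡edgesWithin+arcsLeaving o S = begin
    ∑[ v < n G ] (⟦ v ∈? S ⟧ * outdeg G o v)
      ≡⟨ ∑⟦∈⟧*outdeg≡∑⟦tail∈⟧ o S ⟩
    ∑[ e < m G ] ⟦ tail G o e ∈? S ⟧
      ≡⟨ sum-cong-≗ (⟦tail∈⟧≡⟦Inside⟧+⟦Leaves⟧ o S) ⟩
    ∑[ e < m G ] (⟦ inside? S e ⟧ + ⟦ leaves? o S e ⟧)
      ≡⟨ ∑-distrib-+ (λ e → ⟦ inside? S e ⟧) (λ e → ⟦ leaves? o S e ⟧) ⟩
    edgesWithin S + arcsLeaving o S
      ∎
    where open ≡-Reasoning

  Equivalent⇒arcsLeaving≡ : ∀ o₁ o₂ → Equivalent G o₁ o₂ → ∀ S → arcsLeaving o₁ S ≡ arcsLeaving o₂ S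
  Equivalent⇒arcsLeaving≡ o₁ o₂ eqv S = +-cancelˡ-≡ (edgesWithin S) _ _ (begin
    edgesWithin S + arcsLeaving o₁ S
      ≡⟨ sym (∑⟦∈⟧*outdeg≡edgesWithin+arcsLeaving o₁ S) ⟩
    ∑[ v < n G ] (⟦ v ∈? S ⟧ * outdeg G o₁ v)
      ≡⟨ sum-cong-≗ (λ v → cong (⟦ v ∈? S ⟧ *_) (eqv v)) ⟩
    ∑[ v < n G ] (⟦ v ∈? S ⟧ * outdeg G o₂ v)
      ≡⟨ ∑⟦∈⟧*outdeg≡edgesWithin+arcsLeaving o₂ S ⟩
    edgesWithin S + arcsLeaving o₂ S
      ∎)
    where open ≡-Reasoning

  arcsLeaving≡0⇔Closed : ∀ o S → arcsLeaving o S ≡ 0 ⇔ Closed o S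
  arcsLeaving≡0⇔Closed o S = ∑⟦⟧≡0⇔∀¬ (leaves? o S)

  Equivalent⇒Closed : ∀ o₁ o₂ → Equivalent G o₁ o₂ → ∀ S → Closed o₁ S → Closed o₂ S
  Equivalent⇒Closed o₁ o₂ eqv S closed =
    Equivalence.to (arcsLeaving≡0⇔Closed o₂ S)
      (trans (sym (Equivalent⇒arcsLeaving≡ o₁ o₂ eqv S)) (Equivalence.from (arcsLeaving≡0⇔Closed o₁ S) closed))

  closed-arc : ∀ o {S} → Closed o S → ∀ e → tail G o e ∈ S → head G o e ∈ S
  closed-arc o {S} closed e t∈S = decidable-stable (head G o e ∈? S) (λ h∉S → closed e (t∈S , h∉S))

  Closed⇒Reach-preserves-∈ : ∀ o {S} → Closed o S → ∀ {u v} → Reach G o u v → u ∈ S → v ∈ S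
  Closed⇒Reach-preserves-∈ o closed ε                       u∈S = u∈S
  Closed⇒Reach-preserves-∈ o closed ((e , refl , refl) ◅ r) u∈S =
    Closed⇒Reach-preserves-∈ o closed r (closed-arc o closed e u∈S)

  module _ (o : Orientation G) (i : Vertex G) where

    ReachableFrom : Subset (n G) → Set
    ReachableFrom S = ∀ {v} → v ∈ S → Reach G o i v

    ReachableFrom-∪-head : ∀ {S} e → ReachableFrom S → tail G o e ∈ S →
      ReachableFrom (S ∪ ⁅ head G o e ⁆)
    ReachableFrom-∪-head {S} e reach t∈S v∈ with x∈p∪q⁻ S _ v∈
    ... | inj₁ v∈S = reach v∈S
    ... | inj₂ v∈h rewrite x∈⁅y⁆⇒x≡y _ v∈h = reach t∈S ◅◅ ((e , refl , refl) ◅ ε)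

    closedExtension : ∀ S → Acc _⊃_ S → ReachableFrom S →
      ∃[ T ] S ⊆ T × Closed o T × ReachableFrom T
    closedExtension S (acc rec) reach with any? (leaves? o S)
    ... | no none = S , id , (λ e l → none (e , l)) , reach
    ... | yes (e , t∈S , h∉S)
      with closedExtension (S ∪ ⁅ head G o e ⁆) (rec (x∉p⇒p⊂p∪⁅x⁆ h∉S))
             (ReachableFrom-∪-head e reach t∈S)
    ...   | T , S∪h⊆T , closed , reachT = T , S∪h⊆T ∘ p⊆p∪q _ , closed , reachT

    closedReachableSet : ∃[ T ] i ∈ T × Closed o T × ReachableFrom T
    closedReachableSet with closedExtension ⁅ i ⁆ (⊃-wellFounded _) reach-i
      where
      reach-i : ReachableFrom ⁅ i ⁆
      reach-i v∈ rewrite x∈⁅y⁆⇒x≡y i v∈ = ε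
    ... | T , i⊆T , closed , reachT = T , i⊆T (x∈⁅x⁆ i) , closed , reachT

  Equivalent⇒Reach : ∀ o₁ o₂ → Equivalent G o₁ o₂ → ∀ {i j} → Reach G o₂ i j → Reach G o₁ i j
  Equivalent⇒Reach o₁ o₂ eqv {i} r with closedReachableSet o₁ i
  ... | T , i∈T , closed , reachT =
    reachT (Closed⇒Reach-preserves-∈ o₂ (Equivalent⇒Closed o₁ o₂ eqv T closed) r i∈T)

corollary2p3 : (G : Multigraph) (o₁ o₂ : Orientation G) →
    Equivalent G o₁ o₂ →
    ∀ (i j : Vertex G) → SameSCC G o₁ i j ⇔ SameSCC G o₂ i j
corollary2p3 G o₁ o₂ eqv i j = mk⇔ (Product.map reach₁⇒reach₂ reach₁⇒reach₂)
                                   (Product.map reach₂⇒reach₁ reach₂⇒reach₁)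
  where
  reach₁⇒reach₂ : ∀ {u v} → Reach G o₁ u v → Reach G o₂ u v
  reach₁⇒reach₂ = Equivalent⇒Reach G o₂ o₁ (sym ∘ eqv)
  reach₂⇒reach₁ : ∀ {u v} → Reach G o₂ u v → Reach G o₁ u v
  reach₂⇒reach₁ = Equivalent⇒Reach G o₁ o₂ eqv
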